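{- Let $Q$ be finite, $\rho:Q\to\mathbb{N}$ with maximum $m$, and $\mathcal{D}^k$ as in the context. For each $k\le m$ and each simple type $A$, $\mathcal{D}^k_A$ is a non-empty lattice. Moreover for $0<k\le m$: for every $d_2\in\mathcal{D}^k_A$ and $e_1\in\mathcal{D}^{k-1}_A$, $d_2^{\downarrow}\le e_1$ iff $d_2\le e_1^{\uparrow\top}$ (so $(\cdot)^\downarrow$ and $(\cdot)^{\uparrow\top}$ form a Galois connection); and for every $d_1\in\mathcal{D}^{k-1}_A$ and $e_2\in\mathcal{D}^k_A$, $d_1^{\uparrow\bot}\le e_2$ iff $d_1\le e_2^{\downarrow}$ (so $(\cdot)^{\uparrow\bot}$ and $(\cdot)^\downarrow$ form a Galois connection).
   Context: $Q_k=\{q:\rho(q)=k\}$, $Q_{\le k}=\{q:\rho(q)\le k\}$. $\mathcal{D}^0_o=\mathcal{P}(Q_0)$, $\mathcal{D}^0_{A\to B}$ = monotone maps $\mathcal{D}^0_A\to\mathcal{D}^0_B$; for $k>0$: $\mathcal{D}^k_o=\mathcal{P}(Q_{\le k})$, $\mathcal{L}^k_o=\{(R,P): R=P\cap Q_{\le k-1}\}$, $\mathcal{L}^k_{A\to B}=\{(f_1,f_2): f_1\in\mathcal{D}^{k-1}_{A\to B}$, $f_2$ monotone $\mathcal{D}^k_A\to\mathcal{D}^k_B$, $(f_1(g_1),f_2(g_2))\in\mathcal{L}^k_B$ whenever $(g_1,g_2)\in\mathcal{L}^k_A\}$, $\mathcal{D}^k_{A\to B}=\{f_2:\exists f_1,(f_1,f_2)\in\mathcal{L}^k_{A\to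 B}\}$; order is inclusion at $o$ and pointwise at arrows. For $k>0$: $e^\downarrow$ denotes the unique $d\in\mathcal{D}^{k-1}_A$ with $(d,e)\in\mathcal{L}^k_A$; for $d\in\mathcal{D}^{k-1}_A$, $d^{\uparrow\top}$ and $d^{\uparrow\bot}$ denote the greatest and least elements of $\{e\in\mathcal{D}^k_A:(d,e)\in\mathcal{L}^k_A\}$ (these exist and are unique). -}

module Defs where

open import Data.Nat using (ℕ; zero; suc; _≤_; _≤?_)
open import Data.Fin using (Fin)
open import Data.Bool using (Bool; T; _∧_)
open import Data.Product using (Σ; _×_; ∃)
open import Relation.Binary.PropositionalEquality using (_≡_)
open import Relation.Nullary.Decidable using (⌊_⌋)
open import Relation.Binary.Lattice using (IsLattice)
open import Algebra.Core using (Op₂)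

infixr 5 _⇒_
data Ty : Set where
  o   : Ty
  _⇒_ : Ty → Ty → Ty

IsMaxOf : {n : ℕ} → (Fin n → ℕ) → ℕ → Set
IsMaxOf ρ m = (∀ q → ρ q ≤ m) × ∃ λ q → ρ q ≡ m

-- The finite set Q is Fin n; ρ : Q → ℕ.
module Sem (n : ℕ) (ρ : Fin n → ℕ) where

  Sub : Set
  Sub = Fin n → Bool

  DO : ℕ → Set
  DO k = Σ Sub λ P → ∀ q → T (P q) → ρ q ≤ k

  inLe : ℕ → Fin n → Bool
  inLe k q = ⌊ ρ q ≤? k ⌋

  mutual
    D : ℕ → Ty → Set
    D k o = DO k
    D zero (A ⇒ B) = Σ (D zero A → D zero B) (Mono zero A B)
    D (suc k) (A ⇒ B) =
      Σ (D (suc k) A → D (suc k) B) λ f₂ →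
        Mono (suc k) A B f₂ ×
        Σ (D k (A ⇒ B)) λ f₁ →
          ∀ g₁ g₂ → L k A g₁ g₂ → L k B (app k f₁ g₁) (f₂ g₂)

    Le : ∀ k A → D k A → D k A → Set
    Le k o P R = ∀ q → T (Σ.proj₁ P q) → T (Σ.proj₁ R q)
    Le k (A ⇒ B) f g = ∀ x → Le k B (app k f x) (app k g x)

    Mono : ∀ k A B → (D k A → D k B) → Set
    Mono k A B f = ∀ x y → Le k A x y → Le k B (f x) (f y)

    app : ∀ k {A B} → D k (A ⇒ B) → D k A → D k B
    app zero f = Σ.proj₁ f
    app (suc k) f = Σ.proj₁ f

    -- L k A d e  is  (d , e) ∈ 𝓛^{k+1}_A  with d ∈ 𝒟^k_A, e ∈ 𝒟^{k+1}_A
    L : ∀ k A → D k A → D (suc k) A → Set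
    L k o R P = ∀ q → Σ.proj₁ R q ≡ (Σ.proj₁ P q ∧ inLe k q)
    L k (A ⇒ B) f₁ f₂ =
      ∀ g₁ g₂ → L k A g₁ g₂ → L k B (app k f₁ g₁) (app (suc k) f₂ g₂)

  Eq : ∀ k A → D k A → D k A → Set
  Eq k A x y = Le k A x y × Le k A y x

  NonEmptyLattice : ℕ → Ty → Set
  NonEmptyLattice k A =
    D k A × Σ (Op₂ (D k A)) λ _∨_ → Σ (Op₂ (D k A)) λ _∧_ →
      IsLattice (Eq k A) (Le k A) _∨_ _∧_

  IsUpTop : ∀ k A → D k A → D (suc k) A → Set
  IsUpTop k A d u = L k A d u × (∀ e → L k A d e → Le (suc k) A e u)

  IsUpBot : ∀ k A → D k A → D (suc k) A → Set
  IsUpBot k A d b = L k A d b × (∀ e → L k A d e → Le (suc k) A b e)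

-- Join, meet and bottom are
-- computed pointwise from union, intersection and the empty set at o, and they preserve
-- 𝓛 because intersecting with Q_{≤k} distributes over union and intersection.
-- The restriction e ↦ e↓ is monotone; at an arrow type this is tested on lifts of the
-- arguments, so monotonicity of ↓ and the lifts are built together.  Both Galois
-- connections follow from explicit lifts of d ∈ 𝒟^{k-1}: at o, d^{↑⊥} = d and
-- d^{↑⊤} = d ∪ Q_k, and at A → B, f^{↑}(g) = (f(g↓))^{↑}.
module Submission where

open import Defs
open import Algebra.Core using (Op₂)
open import Data.Bool using (Bool; true; false; T; _∧_; _∨_; not)
open import Data.Bool.Properties using (∧-zeroʳ; ∧-identityʳ; T-∧; T-∨)
open import Data.Empty using (⊥-elim)
open import Data.Fin using (Fin)
open import Data.Nat using (ℕ; zero; suc; _≤_)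
open import Data.Nat.Properties using (m≤n⇒m≤1+n)
open import Data.Product as Product using (_×_; _,_; proj₁; proj₂; swap)
open import Data.Sum as Sum using (_⊎_; inj₁; inj₂; [_,_])
open import Data.Unit using (tt)
open import Function.Base using (_∘_; id)
open import Function.Bundles using (_⇔_; mk⇔; module Equivalence)
open Equivalence using (to; from)
open import Level using (0ℓ)
open import Relation.Binary.Bundles using (Preorder)
open import Relation.Binary.Structures using (IsPartialOrder)
open import Relation.Binary.PropositionalEquality using (_≡_; refl; sym; trans; subst; cong₂)
open import Relation.Nullary.Decidable using (toWitness; fromWitness)

T-injective : ∀ x y → (T x → T y) → (T y → T x) → x ≡ y
T-injective true  true  _ _ = refl
T-injective true  false h _ = ⊥-elim (h tt)
T-injective false true  _ h = ⊥-elim (h tt)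
T-injective false false _ _ = refl

T-∧-mono : ∀ x x' y y' → (T x → T x') → (T y → T y') → T (x ∧ y) → T (x' ∧ y')
T-∧-mono x x' y y' f g = from (T-∧ {x'} {y'}) ∘ Product.map f g ∘ to (T-∧ {x} {y})

T-∨-mono : ∀ x x' y y' → (T x → T x') → (T y → T y') → T (x ∨ y) → T (x' ∨ y')
T-∨-mono x x' y y' f g = from (T-∨ {x'} {y'}) ∘ Sum.map f g ∘ to (T-∨ {x} {y})

module Properties (n : ℕ) (ρ : Fin n → ℕ) where
  open Sem n ρ

  Le-refl : ∀ k A (x : D k A) → Le k A x x
  Le-refl k o       x q = id
  Le-refl k (A ⇒ B) f x = Le-refl k B (app k f x)

  Le-trans : ∀ k A (x y z : D k A) → Le k A x y → Le k A y z → Le k A x z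
  Le-trans k o       x y z x≤y y≤z q t = y≤z q (x≤y q t)
  Le-trans k (A ⇒ B) f g h f≤g g≤h x = Le-trans k B _ _ _ (f≤g x) (g≤h x)

  Le-isPartialOrder : ∀ k A → IsPartialOrder (Eq k A) (Le k A)
  Le-isPartialOrder k A = record
    { isPreorder = record
      { isEquivalence = record
        { refl  = λ {x} → Le-refl k A x , Le-refl k A x
        ; sym   = swap
        ; trans = λ {x} {y} {z} (x≤y , y≤x) (y≤z , z≤y) →
                    Le-trans k A x y z x≤y y≤z , Le-trans k A z y x z≤y y≤x
        }
      ; reflexive = proj₁
      ; trans     = λ {x} {y} {z} → Le-trans k A x y z
      }
    ; antisym = _,_
    }

  Le-preorder : ℕ → Ty → Preorder 0ℓ 0ℓ 0ℓ
  Le-preorder k A = record { isPreorder = IsPartialOrder.isPreorder (Le-isPartialOrder k A) }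

  app-mono : ∀ k {A B} (f : D k (A ⇒ B)) → Mono k A B (app k f)
  app-mono zero    f = proj₂ f
  app-mono (suc k) f = proj₁ (proj₂ f)

  L-respˡ-Eq : ∀ k A {a a' b} → Eq k A a a' → L k A a b → L k A a' b
  L-respˡ-Eq k o       {a} {a'} (a≤a' , a'≤a) l q =
    trans (T-injective (proj₁ a' q) (proj₁ a q) (a'≤a q) (a≤a' q)) (l q)
  L-respˡ-Eq k (A ⇒ B) (f≤f' , f'≤f) l g₁ g₂ lg =
    L-respˡ-Eq k B (f≤f' g₁ , f'≤f g₁) (l g₁ g₂ lg)

  module Pointwise
      (_⊕_    : Op₂ Bool)
      (⊕-mono : ∀ x x' y y' → (T x → T x') → (T y → T y') → T (x ⊕ y) → T (x' ⊕ y'))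
      (⊕-zero : false ⊕ false ≡ false)
    where

    ⊕-positive : ∀ x y → T (x ⊕ y) → T x ⊎ T y
    ⊕-positive true  y     _ = inj₁ tt
    ⊕-positive false true  _ = inj₂ tt
    ⊕-positive false false t rewrite ⊕-zero = ⊥-elim t

    ∧-distribʳ-⊕ : ∀ x y z → (x ∧ z) ⊕ (y ∧ z) ≡ (x ⊕ y) ∧ z
    ∧-distribʳ-⊕ x y true
      rewrite ∧-identityʳ x | ∧-identityʳ y | ∧-identityʳ (x ⊕ y) = refl
    ∧-distribʳ-⊕ x y false
      rewrite ∧-zeroʳ x | ∧-zeroʳ y | ∧-zeroʳ (x ⊕ y) = ⊕-zero

    mutual
      pointwise : ∀ k A → Op₂ (D k A)
      pointwise k o (P , p) (R , r) =
        (λ q → P q ⊕ R q) , λ q t → [ p q , r q ] (⊕-positive (P q) (R q) t)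
      pointwise zero (A ⇒ B) f g =
        (λ x → pointwise zero B (app zero f x) (app zero g x)) ,
        λ x y x≤y → pointwise-mono zero B _ _ _ _ (app-mono zero f x y x≤y) (app-mono zero g x y x≤y)
      pointwise (suc k) (A ⇒ B) f g =
        (λ x → pointwise (suc k) B (app (suc k) f x) (app (suc k) g x)) ,
        (λ x y x≤y →
           pointwise-mono (suc k) B _ _ _ _ (app-mono (suc k) f x y x≤y) (app-mono (suc k) g x y x≤y)) ,
        pointwise k (A ⇒ B) (proj₁ (proj₂ (proj₂ f))) (proj₁ (proj₂ (proj₂ g))) ,
        L-pointwise-⇒ k A B _ _ f g (proj₂ (proj₂ (proj₂ f))) (proj₂ (proj₂ (proj₂ g)))

      pointwise-mono : ∀ k A x y x' y' → Le k A x x' → Le k A y y' →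
        Le k A (pointwise k A x y) (pointwise k A x' y')
      pointwise-mono k       o       x y x' y' x≤x' y≤y' q =
        ⊕-mono (proj₁ x q) (proj₁ x' q) (proj₁ y q) (proj₁ y' q) (x≤x' q) (y≤y' q)
      pointwise-mono zero    (A ⇒ B) f g f' g' f≤f' g≤g' x = pointwise-mono zero B _ _ _ _ (f≤f' x) (g≤g' x)
      pointwise-mono (suc k) (A ⇒ B) f g f' g' f≤f' g≤g' x = pointwise-mono (suc k) B _ _ _ _ (f≤f' x) (g≤g' x)

      L-pointwise : ∀ k A a a' b b' → L k A a b → L k A a' b' →
        L k A (pointwise k A a a') (pointwise (suc k) A b b')
      L-pointwise k o       a a' b b' l l' q =
        trans (cong₂ _⊕_ (l q) (l' q)) (∧-distribʳ-⊕ (proj₁ b q) (proj₁ b' q) (inLe k q))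
      L-pointwise k (A ⇒ B) = L-pointwise-⇒ k A B

      L-pointwise-⇒ : ∀ k A B (f₁ g₁ : D k (A ⇒ B)) (f₂ g₂ : D (suc k) (A ⇒ B)) →
        L k (A ⇒ B) f₁ f₂ → L k (A ⇒ B) g₁ g₂ →
        ∀ x y → L k A x y →
        L k B (app k (pointwise k (A ⇒ B) f₁ g₁) x) (pointwise (suc k) B (app (suc k) f₂ y) (app (suc k) g₂ y))
      L-pointwise-⇒ zero    A B _ _ _ _ lf lg x y l = L-pointwise zero B _ _ _ _ (lf x y l) (lg x y l)
      L-pointwise-⇒ (suc k) A B _ _ _ _ lf lg x y l = L-pointwise (suc k) B _ _ _ _ (lf x y l) (lg x y l)

  open Pointwise _∨_ T-∨-mono refl using () renaming (pointwise to join)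
  open Pointwise _∧_ T-∧-mono refl using () renaming (pointwise to meet)

  join-upperˡ : ∀ k A x y → Le k A x (join k A x y)
  join-upperˡ k       o       x y q t = from (T-∨ {proj₁ x q} {proj₁ y q}) (inj₁ t)
  join-upperˡ zero    (A ⇒ B) f g x   = join-upperˡ zero B _ _
  join-upperˡ (suc k) (A ⇒ B) f g x   = join-upperˡ (suc k) B _ _

  join-upperʳ : ∀ k A x y → Le k A y (join k A x y)
  join-upperʳ k       o       x y q t = from (T-∨ {proj₁ x q} {proj₁ y q}) (inj₂ t)
  join-upperʳ zero    (A ⇒ B) f g x   = join-upperʳ zero B _ _
  join-upperʳ (suc k) (A ⇒ B) f g x   = join-upperʳ (suc k) B _ _

  join-least : ∀ k A x y z → Le k A x z → Le k A y z → Le k A (join k A x y) z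
  join-least k       o       x y z x≤z y≤z q t = [ x≤z q , y≤z q ] (to (T-∨ {proj₁ x q} {proj₁ y q}) t)
  join-least zero    (A ⇒ B) f g h f≤h g≤h x   = join-least zero B _ _ _ (f≤h x) (g≤h x)
  join-least (suc k) (A ⇒ B) f g h f≤h g≤h x   = join-least (suc k) B _ _ _ (f≤h x) (g≤h x)

  meet-lowerˡ : ∀ k A x y → Le k A (meet k A x y) x
  meet-lowerˡ k       o       x y q t = proj₁ (to (T-∧ {proj₁ x q} {proj₁ y q}) t)
  meet-lowerˡ zero    (A ⇒ B) f g x   = meet-lowerˡ zero B _ _
  meet-lowerˡ (suc k) (A ⇒ B) f g x   = meet-lowerˡ (suc k) B _ _

  meet-lowerʳ : ∀ k A x y → Le k A (meet k A x y) y
  meet-lowerʳ k       o       x y q t = proj₂ (to (T-∧ {proj₁ x q} {proj₁ y q}) t)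
  meet-lowerʳ zero    (A ⇒ B) f g x   = meet-lowerʳ zero B _ _
  meet-lowerʳ (suc k) (A ⇒ B) f g x   = meet-lowerʳ (suc k) B _ _

  meet-greatest : ∀ k A x y z → Le k A z x → Le k A z y → Le k A z (meet k A x y)
  meet-greatest k       o       x y z z≤x z≤y q t =
    from (T-∧ {proj₁ x q} {proj₁ y q}) (z≤x q t , z≤y q t)
  meet-greatest zero    (A ⇒ B) f g h h≤f h≤g x   = meet-greatest zero B _ _ _ (h≤f x) (h≤g x)
  meet-greatest (suc k) (A ⇒ B) f g h h≤f h≤g x   = meet-greatest (suc k) B _ _ _ (h≤f x) (h≤g x)

  mutual
    bot : ∀ k A → D k A
    bot k       o       = (λ _ → false) , λ _ ()
    bot zero    (A ⇒ B) = (λ _ → bot zero B) , λ _ _ _ → Le-refl zero B (bot zero B)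
    bot (suc k) (A ⇒ B) =
      (λ _ → bot (suc k) B) , (λ _ _ _ → Le-refl (suc k) B (bot (suc k) B)) ,
      bot k (A ⇒ B) , λ x _ _ → L-bot-⇒ k A B x

    L-bot-⇒ : ∀ k A B x → L k B (app k (bot k (A ⇒ B)) x) (bot (suc k) B)
    L-bot-⇒ zero    A B x = L-bot zero B
    L-bot-⇒ (suc k) A B x = L-bot (suc k) B

    L-bot : ∀ k A → L k A (bot k A) (bot (suc k) A)
    L-bot k o       q       = refl
    L-bot k (A ⇒ B) x _ _   = L-bot-⇒ k A B x

  nonEmptyLattice : ∀ k A → NonEmptyLattice k A
  nonEmptyLattice k A = bot k A , join k A , meet k A , record
    { isPartialOrder = Le-isPartialOrder k A
    ; supremum       = λ x y → join-upperˡ k A x y , join-upperʳ k A x y , join-least k A x y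
    ; infimum        = λ x y → meet-lowerˡ k A x y , meet-lowerʳ k A x y , meet-greatest k A x y
    }

  module Restriction (j : ℕ) where

    inLe-suc : ∀ q → T (inLe j q) → T (inLe (suc j) q)
    inLe-suc q = fromWitness ∘ m≤n⇒m≤1+n ∘ toWitness

    down : ∀ A → D (suc j) A → D j A
    down o       (P , _) =
      (λ q → P q ∧ inLe j q) , λ q t → toWitness (proj₂ (to (T-∧ {P q} {inLe j q}) t))
    down (A ⇒ B) f       = proj₁ (proj₂ (proj₂ f))

    L-down : ∀ A e → L j A (down A e) e
    L-down o       e = λ _ → refl
    L-down (A ⇒ B) f = proj₂ (proj₂ (proj₂ f))

    module Extension
        (up₀      : D j o → D (suc j) o)
        (up₀-mono : ∀ R R' → Le j o R R' → Le (suc j) o (up₀ R) (up₀ R'))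
        (L-up₀    : ∀ R → L j o R (up₀ R))
      where

      mutual
        up : ∀ A → D j A → D (suc j) A
        up o       = up₀
        up (A ⇒ B) f =
          (λ g → up B (app j f (down A g))) ,
          (λ g g' g≤g' →
             up-mono B _ _ (app-mono j f _ _ (L-mono A _ _ _ _ (L-down A g) (L-down A g') g≤g'))) ,
          f , L-up-⇒ A B f

        up-mono : ∀ A d d' → Le j A d d' → Le (suc j) A (up A d) (up A d')
        up-mono o       = up₀-mono
        up-mono (A ⇒ B) f f' f≤f' g = up-mono B _ _ (f≤f' (down A g))

        L-up : ∀ A d → L j A d (up A d)
        L-up o       = L-up₀
        L-up (A ⇒ B) = L-up-⇒ A B

        L-up-⇒ : ∀ A B (f : D j (A ⇒ B)) g₁ g₂ → L j A g₁ g₂ →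
          L j B (app j f g₁) (up B (app j f (down A g₂)))
        L-up-⇒ A B f g₁ g₂ l =
          L-respˡ-Eq j B (app-mono j f _ _ g₂↓≤g₁ , app-mono j f _ _ g₁≤g₂↓) (L-up B _)
          where
          g₂↓≤g₁ : Le j A (down A g₂) g₁
          g₂↓≤g₁ = L-mono A _ _ _ _ (L-down A g₂) l (Le-refl (suc j) A g₂)
          g₁≤g₂↓ : Le j A g₁ (down A g₂)
          g₁≤g₂↓ = L-mono A _ _ _ _ l (L-down A g₂) (Le-refl (suc j) A g₂)

        L-mono : ∀ A a b a' b' → L j A a b → L j A a' b' → Le (suc j) A b b' → Le j A a a'
        L-mono o       a b a' b' l l' b≤b' q t =
          subst T (sym (l' q)) (T-∧-mono (proj₁ b q) (proj₁ b' q) _ _ (b≤b' q) id (subst T (l q) t))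
        L-mono (A ⇒ B) f₁ f₂ f₁' f₂' l l' f₂≤f₂' x =
          L-mono B _ _ _ _ (l x (up A x) (L-up A x)) (l' x (up A x) (L-up A x)) (f₂≤f₂' (up A x))

    -- Q_{≤j+1} ∩ (R ∪ ∁ Q_{≤j}), which is R ∪ Q_{j+1} because R ⊆ Q_{≤j}.
    upTop₀ : D j o → D (suc j) o
    upTop₀ (R , _) =
      (λ q → inLe (suc j) q ∧ (R q ∨ not (inLe j q))) ,
      λ q t → toWitness (proj₁ (to (T-∧ {inLe (suc j) q} {R q ∨ not (inLe j q)}) t))

    upTop₀-mono : ∀ R R' → Le j o R R' → Le (suc j) o (upTop₀ R) (upTop₀ R')
    upTop₀-mono (R , _) (R' , _) R≤R' q =
      T-∧-mono _ _ _ _ id (T-∨-mono (R q) (R' q) _ _ (R≤R' q) id)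

    L-upTop₀ : ∀ R → L j o R (upTop₀ R)
    L-upTop₀ (R , R≤j) q = restrict (R q) (inLe j q) (inLe (suc j) q) (fromWitness ∘ R≤j q) (inLe-suc q)
      where
      restrict : ∀ r a b → (T r → T a) → (T a → T b) → r ≡ (b ∧ (r ∨ not a)) ∧ a
      restrict true  true  true  _ _ = refl
      restrict true  true  false _ h = ⊥-elim (h tt)
      restrict true  false _     h _ = ⊥-elim (h tt)
      restrict false true  true  _ _ = refl
      restrict false true  false _ h = ⊥-elim (h tt)
      restrict false false b     _ _ = sym (∧-zeroʳ (b ∧ true))

    upBot₀ : D j o → D (suc j) o
    upBot₀ (R , R≤j) = R , λ q t → m≤n⇒m≤1+n (R≤j q t)

    L-upBot₀ : ∀ R → L j o R (upBot₀ R)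
    L-upBot₀ (R , R≤j) q =
      T-injective (R q) (R q ∧ inLe j q)
        (λ t → from (T-∧ {R q} {inLe j q}) (t , fromWitness (R≤j q t)))
        (proj₁ ∘ to (T-∧ {R q} {inLe j q}))

    open Extension upTop₀ upTop₀-mono L-upTop₀
      using (L-mono) renaming (up to upTop; up-mono to upTop-mono; L-up to L-upTop)
    open Extension upBot₀ (λ _ _ R≤R' → R≤R') L-upBot₀
      using () renaming (up to upBot; up-mono to upBot-mono; L-up to L-upBot)

    upTop-greatest : ∀ A d e → L j A d e → Le (suc j) A e (upTop A d)
    upTop-greatest o       (R , _) (E , E≤sj) l q t =
      from (T-∧ {inLe (suc j) q}) (fromWitness (E≤sj q t) , covered (R q) (E q) (inLe j q) (l q) t)
      where
      covered : ∀ r e a → r ≡ e ∧ a → T e → T (r ∨ not a)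
      covered true  e     a     _ _ = tt
      covered false e     false _ _ = tt
      covered false true  true  () _
      covered false false a     _ ()
    upTop-greatest (A ⇒ B) f e l g =
      upTop-greatest B _ _ (l (down A g) g (L-down A g))

    upBot-least : ∀ A d e → L j A d e → Le (suc j) A (upBot A d) e
    upBot-least o       (R , _) (E , _) l q t = proj₁ (to (T-∧ {E q} {inLe j q}) (subst T (l q) t))
    upBot-least (A ⇒ B) f e l g =
      upBot-least B _ _ (l (down A g) g (L-down A g))

    down⊣upTop : ∀ A (d₂ : D (suc j) A) (e₁ : D j A) (d₂↓ : D j A) (e₁↑⊤ : D (suc j) A) →
      L j A d₂↓ d₂ → IsUpTop j A e₁ e₁↑⊤ → (Le j A d₂↓ e₁ ⇔ Le (suc j) A d₂ e₁↑⊤)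
    down⊣upTop A d₂ e₁ d₂↓ e₁↑⊤ l (l⊤ , greatest) = mk⇔ lift≤ (L-mono A _ _ _ _ l l⊤)
      where
      open import Relation.Binary.Reasoning.Preorder (Le-preorder (suc j) A)
      lift≤ : Le j A d₂↓ e₁ → Le (suc j) A d₂ e₁↑⊤
      lift≤ d₂↓≤e₁ = begin
        d₂               ≲⟨ upTop-greatest A _ _ l ⟩
        upTop A d₂↓      ≲⟨ upTop-mono A _ _ d₂↓≤e₁ ⟩
        upTop A e₁       ≲⟨ greatest _ (L-upTop A e₁) ⟩
        e₁↑⊤             ∎

    upBot⊣down : ∀ A (d₁ : D j A) (e₂ : D (suc j) A) (d₁↑⊥ : D (suc j) A) (e₂↓ : D j A) →
      IsUpBot j A d₁ d₁↑⊥ → L j A e₂↓ e₂ → (Le (suc j) A d₁↑⊥ e₂ ⇔ Le j A d₁ e₂↓)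
    upBot⊣down A d₁ e₂ d₁↑⊥ e₂↓ (l⊥ , least) l = mk⇔ (L-mono A _ _ _ _ l⊥ l) lift≤
      where
      open import Relation.Binary.Reasoning.Preorder (Le-preorder (suc j) A)
      lift≤ : Le j A d₁ e₂↓ → Le (suc j) A d₁↑⊥ e₂
      lift≤ d₁≤e₂↓ = begin
        d₁↑⊥             ≲⟨ least _ (L-upBot A d₁) ⟩
        upBot A d₁       ≲⟨ upBot-mono A _ _ d₁≤e₂↓ ⟩
        upBot A e₂↓      ≲⟨ upBot-least A _ _ l ⟩
        e₂               ∎

corollary4p2 : (n : ℕ) (ρ : Fin n → ℕ) (m : ℕ) → IsMaxOf ρ m →
    let open Sem n ρ in
    (∀ k A → k ≤ m → NonEmptyLattice k A)
    × (∀ j A → suc j ≤ m →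
        (∀ (d₂ : D (suc j) A) (e₁ : D j A) (d₂↓ : D j A) (e₁↑⊤ : D (suc j) A) →
           L j A d₂↓ d₂ → IsUpTop j A e₁ e₁↑⊤ →
           (Le j A d₂↓ e₁ ⇔ Le (suc j) A d₂ e₁↑⊤))
        × (∀ (d₁ : D j A) (e₂ : D (suc j) A) (d₁↑⊥ : D (suc j) A) (e₂↓ : D j A) →
           IsUpBot j A d₁ d₁↑⊥ → L j A e₂↓ e₂ →
           (Le (suc j) A d₁↑⊥ e₂ ⇔ Le j A d₁ e₂↓)))
corollary4p2 n ρ m _ =
  (λ k A _ → nonEmptyLattice k A) ,
  (λ j A _ → Restriction.down⊣upTop j A , Restriction.upBot⊣down j A)
  where open Properties n ρ
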